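{- Let $f(X)\in\mathbb{F}_2[[X]]$ be a formal power series with coefficients in $\mathbb{F}_2$. Suppose there exist an integer $m\ge 1$, polynomials $P_1(X),\dots,P_m(X)\in\mathbb{F}_2[X]$ and positive integers $r_1,\dots,r_m$ and $l_1,\dots,l_m$ such that for every $1\le j\le m$, either $$f(X)=\frac{P_j(X)}{(1+X)^{l_j}+X^{r_j}}\qquad\text{or}\qquad f(X)=\frac{P_j(X)}{X^{r_j}(1+X)^{l_j}+1}.$$ Let $l=\gcd(l_1,\dots,l_m)$. Then there exist a polynomial $P(X)\in\mathbb{F}_2[X]$ and an integer $r\ge 1$ such that either $$f(X)=\frac{P(X)}{(1+X)^l+X^r}\qquad\text{or}\qquad f(X)=\frac{P(X)}{X^r(1+X)^l+1}.$$
   Context: An equality $f=P/D$ with $P,D\in\mathbb{F}_2[X]$ means $D(X)f(X)=P(X)$ in $\mathbb{F}_2[[X]]$. -}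

module Defs where

open import Data.Bool using (Bool; true; false; _xor_; _∧_)
open import Data.Nat using (ℕ; zero; suc; _∸_)
open import Data.Nat.GCD using (gcd)
open import Data.List using (List; []; _∷_; replicate; _++_; foldr; map; upTo)
open import Data.Fin using (Fin)
import Data.Fin as Fin
open import Relation.Binary.PropositionalEquality using (_≡_)

-- The field 𝔽₂ is modelled by Bool with addition _xor_ and multiplication _∧_.

Series : Set
Series = ℕ → Bool

-- Polynomials over 𝔽₂: finite coefficient lists, constant term first.
Poly : Set
Poly = List Bool

coeff : Poly → ℕ → Bool
coeff []      _       = false
coeff (a ∷ _) zero    = a
coeff (_ ∷ p) (suc n) = coeff p n

padd : Poly → Poly → Poly
padd []      q       = q
padd p       []      = p
padd (a ∷ p) (b ∷ q) = (a xor b) ∷ padd p q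

pscale : Bool → Poly → Poly
pscale a = map (a ∧_)

pmul : Poly → Poly → Poly
pmul []      q = []
pmul (a ∷ p) q = padd (pscale a q) (false ∷ pmul p q)

ppow : Poly → ℕ → Poly
ppow p zero    = true ∷ []
ppow p (suc n) = pmul p (ppow p n)

one : Poly
one = true ∷ []

Xpow : ℕ → Poly
Xpow r = replicate r false ++ (true ∷ [])

onePlusX : Poly
onePlusX = true ∷ true ∷ []

denA : ℕ → ℕ → Poly
denA l r = padd (ppow onePlusX l) (Xpow r)

denB : ℕ → ℕ → Poly
denB l r = padd (pmul (Xpow r) (ppow onePlusX l)) one

sum₂ : List Bool → Bool
sum₂ = foldr _xor_ false

mulPS : Poly → Series → Series
mulPS D f n = sum₂ (map (λ i → coeff D i ∧ f (n ∸ i)) (upTo (suc n)))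

-- f = P / D  means  D(X) f(X) = P(X) in 𝔽₂[[X]].
IsQuot : Series → Poly → Poly → Set
IsQuot f P D = ∀ n → mulPS D f n ≡ coeff P n

gcdFin : (m : ℕ) → (Fin m → ℕ) → ℕ
gcdFin zero    l = 0
gcdFin (suc m) l = gcd (l Fin.zero) (gcdFin m (λ j → l (Fin.suc j)))

module Submission where

-- Write g ≈ h when g − h is a polynomial. Each hypothesis says X^s (1+X)^(l_j) f ≈ X^t f
-- for some s, t. Since X and 1 + X commute and multiplication preserves ≈, the set of l
-- admitting such s, t is closed under addition and subtraction, so by Bézout it contains
-- gcd(l_1, …, l_m). As the denominators have constant term 1, the coefficients of f obey
-- a linear recurrence over the finite field 𝔽₂, so f is eventually periodic: X^N f ≈ f
-- with N ≥ 1. This cancels X^s, giving (1+X)^l f ≈ X^r f with r ≥ 1, the first form.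

open import Defs
open import Algebra using (CommutativeRing)
open import Data.Bool using (Bool; true; false; _xor_; _∧_)
open import Data.Bool.Properties
  using (xor-same; xor-identityʳ; ∧-zeroʳ; ∧-distribʳ-xor; xor-∧-commutativeRing)
open import Algebra.Properties.Group (CommutativeRing.+-group xor-∧-commutativeRing)
  using (∙-cancelʳ)
open import Algebra.Properties.CommutativeSemigroup
  (CommutativeRing.+-commutativeSemigroup xor-∧-commutativeRing)
  using (interchange)
open import Data.Fin using (Fin; toℕ; fromℕ<; funToFin; finToFun)
import Data.Fin as Fin
open import Data.Fin.Patterns using (0F)
open import Data.Fin.Properties using (pigeonhole; finToFun-funToFin; toℕ-fromℕ<; 2↔Bool)
open import Data.List using ([]; _∷_; length; applyUpTo)
open import Data.List.Properties using (map-applyUpTo)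
open import Data.Nat using (ℕ; zero; suc; _+_; _*_; _∸_; _^_; _≤_; _<_; z≤n; s≤s; s≤s⁻¹; _<?_)
open import Data.Nat.Properties
open import Data.Nat.GCD using (gcd; gcd-GCD; module Bézout)
open import Data.Nat.Induction using (<-rec)
open import Data.Product using (Σ; ∃; ∃₂; _×_; _,_)
open import Data.Sum using (_⊎_; inj₁; inj₂)
open import Function using (Inverse; Injection; _↔_; _∘_)
open import Function.Properties.Inverse using (↔-sym; ↔⇒↣)
open import Level using (0ℓ)
open import Relation.Binary using (Setoid)
import Relation.Binary.Reasoning.Setoid
open import Relation.Binary.PropositionalEquality
open import Relation.Nullary using (yes; no)

infixl 6 _⊕_
infixr 7 _·_

0ₛ : Series
0ₛ _ = false

_⊕_ : Series → Series → Series
(g ⊕ h) n = g n xor h n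

shift : Series → Series
shift g zero    = false
shift g (suc n) = g n

shiftⁿ : ℕ → Series → Series
shiftⁿ zero    g = g
shiftⁿ (suc k) g = shift (shiftⁿ k g)

-- The product mulPS in Horner form, which admits induction on the polynomial.
_·_ : Poly → Series → Series
([]      · g) n = false
((a ∷ p) · g) n = (a ∧ g n) xor shift (p · g) n

shift-cong : ∀ {g h} → g ≗ h → shift g ≗ shift h
shift-cong g≗h zero    = refl
shift-cong g≗h (suc n) = g≗h n

shift-⊕ : ∀ g h → shift (g ⊕ h) ≗ shift g ⊕ shift h
shift-⊕ g h zero    = refl
shift-⊕ g h (suc n) = refl

shiftⁿ-cong : ∀ k {g h} → g ≗ h → shiftⁿ k g ≗ shiftⁿ k h
shiftⁿ-cong zero    g≗h = g≗h
shiftⁿ-cong (suc k) g≗h = shift-cong (shiftⁿ-cong k g≗h)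

shiftⁿ-+ : ∀ a b g → shiftⁿ a (shiftⁿ b g) ≗ shiftⁿ (a + b) g
shiftⁿ-+ zero    b g n = refl
shiftⁿ-+ (suc a) b g   = shift-cong (shiftⁿ-+ a b g)

shiftⁿ-comm : ∀ a b g → shiftⁿ a (shiftⁿ b g) ≗ shiftⁿ b (shiftⁿ a g)
shiftⁿ-comm a b g n = begin
  shiftⁿ a (shiftⁿ b g) n ≡⟨ shiftⁿ-+ a b g n ⟩
  shiftⁿ (a + b) g n      ≡⟨ cong (λ k → shiftⁿ k g n) (+-comm a b) ⟩
  shiftⁿ (b + a) g n      ≡⟨ shiftⁿ-+ b a g n ⟨
  shiftⁿ b (shiftⁿ a g) n ∎
  where open ≡-Reasoning

shiftⁿ-+-apply : ∀ k g n → shiftⁿ k g (k + n) ≡ g n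
shiftⁿ-+-apply zero    g n = refl
shiftⁿ-+-apply (suc k) g n = shiftⁿ-+-apply k g n

shiftⁿ-0ₛ : ∀ k → shiftⁿ k 0ₛ ≗ 0ₛ
shiftⁿ-0ₛ zero    n       = refl
shiftⁿ-0ₛ (suc k) zero    = refl
shiftⁿ-0ₛ (suc k) (suc n) = shiftⁿ-0ₛ k n

·-congʳ : ∀ p {g h} → g ≗ h → p · g ≗ p · h
·-congʳ []      g≗h n = refl
·-congʳ (a ∷ p) g≗h n = cong₂ (λ x y → (a ∧ x) xor y) (g≗h n) (shift-cong (·-congʳ p g≗h) n)

·-shift : ∀ p g → p · shift g ≗ shift (p · g)
·-shift []      g zero    = refl
·-shift []      g (suc n) = refl
·-shift (a ∷ p) g zero    = trans (xor-identityʳ _) (∧-zeroʳ a)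
·-shift (a ∷ p) g (suc n) = cong ((a ∧ g n) xor_) (·-shift p g n)

·-shiftⁿ : ∀ p k g → p · shiftⁿ k g ≗ shiftⁿ k (p · g)
·-shiftⁿ p zero    g n = refl
·-shiftⁿ p (suc k) g n = trans (·-shift p (shiftⁿ k g) n) (shift-cong (·-shiftⁿ p k g) n)

·-padd : ∀ p q g → padd p q · g ≗ p · g ⊕ q · g
·-padd []      q       g n = refl
·-padd (a ∷ p) []      g n = sym (xor-identityʳ _)
·-padd (a ∷ p) (b ∷ q) g n = begin
  ((a xor b) ∧ g n) xor shift (padd p q · g) n
    ≡⟨ cong₂ _xor_ (∧-distribʳ-xor (g n) a b)
                   (trans (shift-cong (·-padd p q g) n) (shift-⊕ (p · g) (q · g) n)) ⟩
  ((a ∧ g n) xor (b ∧ g n)) xor (shift (p · g) n xor shift (q · g) n)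
    ≡⟨ interchange (a ∧ g n) (b ∧ g n) (shift (p · g) n) (shift (q · g) n) ⟩
  ((a ∧ g n) xor shift (p · g) n) xor ((b ∧ g n) xor shift (q · g) n) ∎
  where open ≡-Reasoning

·-pscale : ∀ a p g → pscale a p · g ≗ (λ n → a ∧ (p · g) n)
·-pscale a     []      g n       = sym (∧-zeroʳ a)
·-pscale true  (b ∷ p) g n       = cong ((b ∧ g n) xor_) (shift-cong (·-pscale true p g) n)
·-pscale false (b ∷ p) g zero    = refl
·-pscale false (b ∷ p) g (suc n) = ·-pscale false p g n

·-one : ∀ g → one · g ≗ g
·-one g zero    = xor-identityʳ (g zero)
·-one g (suc n) = xor-identityʳ (g (suc n))

·-pmul : ∀ p q g → pmul p q · g ≗ p · (q · g)
·-pmul []      q g n = refl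
·-pmul (a ∷ p) q g n =
  trans (·-padd (pscale a q) (false ∷ pmul p q) g n)
        (cong₂ _xor_ (·-pscale a q g n) (shift-cong (·-pmul p q g) n))

·-ppow-+ : ∀ x a b g → ppow x (a + b) · g ≗ ppow x a · (ppow x b · g)
·-ppow-+ x zero    b g n = sym (·-one (ppow x b · g) n)
·-ppow-+ x (suc a) b g n = begin
  (pmul x (ppow x (a + b)) · g) n       ≡⟨ ·-pmul x (ppow x (a + b)) g n ⟩
  (x · (ppow x (a + b) · g)) n          ≡⟨ ·-congʳ x (·-ppow-+ x a b g) n ⟩
  (x · (ppow x a · (ppow x b · g))) n   ≡⟨ ·-pmul x (ppow x a) (ppow x b · g) n ⟨
  (pmul x (ppow x a) · (ppow x b · g)) n ∎
  where open ≡-Reasoning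

·-Xpow : ∀ r g → Xpow r · g ≗ shiftⁿ r g
·-Xpow zero    g = ·-one g
·-Xpow (suc r) g = shift-cong (·-Xpow r g)

·-denA : ∀ l r g → denA l r · g ≗ ppow onePlusX l · g ⊕ shiftⁿ r g
·-denA l r g n = trans (·-padd (ppow onePlusX l) (Xpow r) g n)
                       (cong ((ppow onePlusX l · g) n xor_) (·-Xpow r g n))

·-denB : ∀ l r g → denB l r · g ≗ shiftⁿ r (ppow onePlusX l · g) ⊕ g
·-denB l r g n = trans (·-padd (pmul (Xpow r) (ppow onePlusX l)) one g n)
  (cong₂ _xor_ (trans (·-pmul (Xpow r) (ppow onePlusX l) g n) (·-Xpow r _ n)) (·-one g n))

mulPS≗· : ∀ D f → mulPS D f ≗ D · f
mulPS≗· D f n =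
  trans (cong sum₂ (map-applyUpTo (λ i → i) (λ i → coeff D i ∧ f (n ∸ i)) (suc n)))
        (convolution D n)
  where
  sum₂-false : ∀ k → sum₂ (applyUpTo (λ _ → false) k) ≡ false
  sum₂-false zero    = refl
  sum₂-false (suc k) = sum₂-false k

  convolution : ∀ D n → sum₂ (applyUpTo (λ i → coeff D i ∧ f (n ∸ i)) (suc n)) ≡ (D · f) n
  convolution []      n       = sum₂-false (suc n)
  convolution (a ∷ D) zero    = refl
  convolution (a ∷ D) (suc n) = cong ((a ∧ f (suc n)) xor_) (convolution D n)

EqualFrom : ℕ → Series → Series → Set
EqualFrom a g h = ∀ n → a ≤ n → g n ≡ h n

infix 4 _≈_

_≈_ : Series → Series → Set
g ≈ h = ∃ λ a → EqualFrom a g h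

≈-setoid : Setoid 0ℓ 0ℓ
≈-setoid = record
  { Carrier       = Series
  ; _≈_           = _≈_
  ; isEquivalence = record
    { refl  = 0 , λ _ _ → refl
    ; sym   = λ (a , g≡h) → a , λ n a≤n → sym (g≡h n a≤n)
    ; trans = λ (a , g≡h) (b , h≡k) → a + b , λ n a+b≤n →
        trans (g≡h n (≤-trans (m≤m+n a b) a+b≤n)) (h≡k n (≤-trans (m≤n+m b a) a+b≤n))
    }
  }

open Setoid ≈-setoid using () renaming (sym to ≈-sym; trans to ≈-trans)
module ≈-Reasoning = Relation.Binary.Reasoning.Setoid ≈-setoid

≗⇒≈ : ∀ {g h} → g ≗ h → g ≈ h
≗⇒≈ g≗h = 0 , λ n _ → g≗h n

shiftⁿ-EqualFrom : ∀ k {a g h} → EqualFrom a g h → EqualFrom (k + a) (shiftⁿ k g) (shiftⁿ k h)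
shiftⁿ-EqualFrom zero    g≡h n       a≤n       = g≡h n a≤n
shiftⁿ-EqualFrom (suc k) g≡h (suc n) (s≤s k+a≤n) = shiftⁿ-EqualFrom k g≡h n k+a≤n

shiftⁿ-resp-≈ : ∀ k {g h} → g ≈ h → shiftⁿ k g ≈ shiftⁿ k h
shiftⁿ-resp-≈ k (a , g≡h) = k + a , shiftⁿ-EqualFrom k g≡h

·-local : ∀ p {g h a m} → (∀ k → a ≤ k → k ≤ m → g k ≡ h k) → a + length p ≤ suc m →
          (p · g) m ≡ (p · h) m
·-local []                    g≡h _     = refl
·-local (b ∷ p) {g} {h} {a} {m} g≡h bound =
  cong₂ (λ x y → (b ∧ x) xor y) (g≡h m (≤-trans (m≤m+n a (length p)) a+l≤m) ≤-refl)
                                (tail-local m a+l≤m g≡h)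
  where
  a+l≤m : a + length p ≤ m
  a+l≤m = s≤s⁻¹ (subst (_≤ suc m) (+-suc a (length p)) bound)

  tail-local : ∀ m → a + length p ≤ m → (∀ k → a ≤ k → k ≤ m → g k ≡ h k) →
               shift (p · g) m ≡ shift (p · h) m
  tail-local zero    _     _   = refl
  tail-local (suc m) bound g≡h = ·-local p (λ k a≤k k≤m → g≡h k a≤k (m≤n⇒m≤1+n k≤m)) bound

·-resp-≈ : ∀ p {g h} → g ≈ h → p · g ≈ p · h
·-resp-≈ p (a , g≡h) = a + length p , λ n a+l≤n →
  ·-local p (λ k a≤k _ → g≡h k a≤k) (m≤n⇒m≤1+n a+l≤n)

⊕≈0ₛ⇒≈ : ∀ {g h} → g ⊕ h ≈ 0ₛ → g ≈ h
⊕≈0ₛ⇒≈ {g} {h} (a , g⊕h≡0) = a , λ n a≤n →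
  ∙-cancelʳ (h n) (g n) (h n) (trans (g⊕h≡0 n a≤n) (sym (xor-same (h n))))

≈⇒⊕≈0ₛ : ∀ {g h} → g ≈ h → g ⊕ h ≈ 0ₛ
≈⇒⊕≈0ₛ {g} {h} (a , g≡h) = a , λ n a≤n →
  trans (cong (_xor h n) (g≡h n a≤n)) (xor-same (h n))

coeff-≥length : ∀ P {n} → length P ≤ n → coeff P n ≡ false
coeff-≥length []      _               = refl
coeff-≥length (a ∷ P) {suc n} (s≤s l≤n) = coeff-≥length P l≤n

coeff-applyUpTo-< : ∀ g {B n} → n < B → coeff (applyUpTo g B) n ≡ g n
coeff-applyUpTo-< g {suc B} {zero}  _         = refl
coeff-applyUpTo-< g {suc B} {suc n} (s≤s n<B) = coeff-applyUpTo-< (g ∘ suc) n<B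

coeff-applyUpTo-≥ : ∀ g {B n} → B ≤ n → coeff (applyUpTo g B) n ≡ false
coeff-applyUpTo-≥ g {zero}                z≤n       = refl
coeff-applyUpTo-≥ g {suc B} {suc n} (s≤s B≤n) = coeff-applyUpTo-≥ (g ∘ suc) B≤n

IsQuot⇒≈0ₛ : ∀ f P D → IsQuot f P D → D · f ≈ 0ₛ
IsQuot⇒≈0ₛ f P D f≡P/D = length P , λ n l≤n →
  trans (sym (mulPS≗· D f n)) (trans (f≡P/D n) (coeff-≥length P l≤n))

≈0ₛ⇒IsQuot : ∀ f D → D · f ≈ 0ₛ → ∃ λ Q → IsQuot f Q D
≈0ₛ⇒IsQuot f D (a , Df≡0) = applyUpTo (mulPS D f) a , quot
  where
  quot : IsQuot f (applyUpTo (mulPS D f) a) D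
  quot n with n <? a
  ... | yes n<a = sym (coeff-applyUpTo-< (mulPS D f) n<a)
  ... | no  n≮a = trans (mulPS≗· D f n)
                    (trans (Df≡0 n (≮⇒≥ n≮a)) (sym (coeff-applyUpTo-≥ (mulPS D f) (≮⇒≥ n≮a))))

coeff-padd : ∀ p q n → coeff (padd p q) n ≡ coeff p n xor coeff q n
coeff-padd []      q       n       = refl
coeff-padd (a ∷ p) []      n       = sym (xor-identityʳ _)
coeff-padd (a ∷ p) (b ∷ q) zero    = refl
coeff-padd (a ∷ p) (b ∷ q) (suc n) = coeff-padd p q n

coeff₀-pscale : ∀ a q → coeff (pscale a q) 0 ≡ a ∧ coeff q 0
coeff₀-pscale a []      = sym (∧-zeroʳ a)
coeff₀-pscale a (b ∷ q) = refl

coeff₀-pmul : ∀ p q → coeff (pmul p q) 0 ≡ coeff p 0 ∧ coeff q 0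
coeff₀-pmul []      q = refl
coeff₀-pmul (a ∷ p) q =
  trans (coeff-padd (pscale a q) _ 0) (trans (xor-identityʳ _) (coeff₀-pscale a q))

coeff₀-ppow : ∀ p l → coeff p 0 ≡ true → coeff (ppow p l) 0 ≡ true
coeff₀-ppow p zero    p₀≡1 = refl
coeff₀-ppow p (suc l) p₀≡1 =
  trans (coeff₀-pmul p (ppow p l)) (cong₂ _∧_ p₀≡1 (coeff₀-ppow p l p₀≡1))

coeff₀-denA : ∀ l {r} → 1 ≤ r → coeff (denA l r) 0 ≡ true
coeff₀-denA l {suc r} _ =
  trans (coeff-padd (ppow onePlusX l) (Xpow (suc r)) 0)
        (cong (_xor false) (coeff₀-ppow onePlusX l refl))

coeff₀-denB : ∀ l {r} → 1 ≤ r → coeff (denB l r) 0 ≡ true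
coeff₀-denB l {suc r} _ =
  trans (coeff-padd (pmul (Xpow (suc r)) (ppow onePlusX l)) one 0)
        (cong (_xor true) (coeff₀-pmul (Xpow (suc r)) (ppow onePlusX l)))

-- Since the constant term of the operator is 1, g n is determined by (D · g) n and
-- the preceding length D' values of g.
recurrence-unique : ∀ D' {g h a} →
  EqualFrom a ((true ∷ D') · g) ((true ∷ D') · h) →
  (∀ t → t < length D' → g (a + t) ≡ h (a + t)) →
  EqualFrom a g h
recurrence-unique D' {g} {h} {a} Dg≡Dh initial = <-rec (λ n → a ≤ n → g n ≡ h n) step
  where
  step : ∀ n → (∀ {m} → m < n → a ≤ m → g m ≡ h m) → a ≤ n → g n ≡ h n
  step n earlier a≤n with n ∸ a <? length D'
  ... | yes n∸a<d = subst (λ k → g k ≡ h k) (m+[n∸m]≡n a≤n) (initial (n ∸ a) n∸a<d)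
  ... | no  n∸a≮d = ∙-cancelʳ _ (g n) (h n)
          (trans (Dg≡Dh n a≤n) (cong (h n xor_) (sym (tails-agree n a+d≤n earlier))))
    where
    a+d≤n : a + length D' ≤ n
    a+d≤n = subst (a + length D' ≤_) (m+[n∸m]≡n a≤n) (+-monoʳ-≤ a (≮⇒≥ n∸a≮d))

    tails-agree : ∀ n → a + length D' ≤ n → (∀ {m} → m < n → a ≤ m → g m ≡ h m) →
                  shift (D' · g) n ≡ shift (D' · h) n
    tails-agree zero    _     _       = refl
    tails-agree (suc m) bound earlier = ·-local D' (λ k a≤k k≤m → earlier (s≤s k≤m) a≤k) bound

Bool↔2 : Bool ↔ Fin 2
Bool↔2 = ↔-sym 2↔Bool

windowCode : (d : ℕ) → Series → ℕ → Fin (2 ^ d)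
windowCode d g p = funToFin (λ (t : Fin d) → Inverse.to Bool↔2 (g (p + toℕ t)))

windowCode-injective : ∀ d g h p q → windowCode d g p ≡ windowCode d h q →
                       ∀ t → t < d → g (p + t) ≡ h (q + t)
windowCode-injective d g h p q same t t<d =
  subst (λ k → g (p + k) ≡ h (q + k)) (toℕ-fromℕ< t<d) (Injection.injective (↔⇒↣ Bool↔2) bits-agree)
  where
  u = fromℕ< t<d
  bits-agree : Inverse.to Bool↔2 (g (p + toℕ u)) ≡ Inverse.to Bool↔2 (h (q + toℕ u))
  bits-agree = begin
    Inverse.to Bool↔2 (g (p + toℕ u))  ≡⟨ finToFun-funToFin _ u ⟨
    finToFun (windowCode d g p) u      ≡⟨ cong (λ c → finToFun c u) same ⟩
    finToFun (windowCode d h q) u      ≡⟨ finToFun-funToFin _ u ⟩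
    Inverse.to Bool↔2 (h (q + toℕ u))  ∎
    where open ≡-Reasoning

EventuallyPeriodic : Series → Set
EventuallyPeriodic f = ∃ λ N → 1 ≤ N × shiftⁿ N f ≈ f

-- Among 2^d + 1 windows of length d of f, two coincide; both f and its shift by the
-- distance N between them then satisfy the recurrence D and agree on a window.
eventually-periodic : ∀ D {f} → coeff D 0 ≡ true → D · f ≈ 0ₛ → EventuallyPeriodic f
eventually-periodic []           () _
eventually-periodic (false ∷ D') () _
eventually-periodic (true ∷ D') {f} refl (B , Df≡0)
  with pigeonhole (n<1+n (2 ^ length D')) (λ k → windowCode (length D') f (toℕ k + B))
... | i , j , i<j , same = N , m<n⇒0<n∸m i<j , a , recurrence-unique D' DfN≡Df initial
  where
  open ≡-Reasoning
  D = true ∷ D'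
  N = toℕ j ∸ toℕ i
  a = N + (toℕ i + B)

  j+B≡a : toℕ j + B ≡ a
  j+B≡a = trans (cong (_+ B) (sym (m∸n+n≡m (<⇒≤ i<j)))) (+-assoc N (toℕ i) B)

  DfN≡Df : EqualFrom a (D · shiftⁿ N f) (D · f)
  DfN≡Df n a≤n = begin
    (D · shiftⁿ N f) n   ≡⟨ ·-shiftⁿ D N f n ⟩
    shiftⁿ N (D · f) n   ≡⟨ shiftⁿ-EqualFrom N Df≡0 n (≤-trans (+-monoʳ-≤ N (m≤n+m B _)) a≤n) ⟩
    shiftⁿ N 0ₛ n        ≡⟨ shiftⁿ-0ₛ N n ⟩
    false                ≡⟨ Df≡0 n (≤-trans (≤-trans (m≤n+m B _) (m≤n+m _ N)) a≤n) ⟨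
    (D · f) n            ∎

  initial : ∀ t → t < length D' → shiftⁿ N f (a + t) ≡ f (a + t)
  initial t t<d = begin
    shiftⁿ N f (a + t)                ≡⟨ cong (shiftⁿ N f) (+-assoc N _ t) ⟩
    shiftⁿ N f (N + (toℕ i + B + t))  ≡⟨ shiftⁿ-+-apply N f _ ⟩
    f (toℕ i + B + t)                 ≡⟨ windowCode-injective _ f f _ _ same t t<d ⟩
    f (toℕ j + B + t)                 ≡⟨ cong (λ k → f (k + t)) j+B≡a ⟩
    f (a + t)                         ∎

module _ {ℓ} (G : ℕ → Set ℓ)
         (G-0 : G 0)
         (G-+ : ∀ {a b} → G a → G b → G (a + b))
         (G-∸ : ∀ {a b} → G a → G (b + a) → G b)
         where

  *-closed : ∀ k {a} → G a → G (k * a)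
  *-closed zero    Ga = G-0
  *-closed (suc k) Ga = G-+ Ga (*-closed k Ga)

  gcd-closed : ∀ {a b} → G a → G b → G (gcd a b)
  gcd-closed {a} {b} Ga Gb with Bézout.identity (gcd-GCD a b)
  ... | Bézout.+- x y eq = G-∸ (*-closed y Gb) (subst G (sym eq) (*-closed x Ga))
  ... | Bézout.-+ x y eq = G-∸ (*-closed x Ga) (subst G (sym eq) (*-closed y Gb))

  gcdFin-closed : ∀ m (l : Fin m → ℕ) → (∀ j → G (l j)) → G (gcdFin m l)
  gcdFin-closed zero    l Gl = G-0
  gcdFin-closed (suc m) l Gl =
    gcd-closed (Gl 0F) (gcdFin-closed m (l ∘ Fin.suc) (Gl ∘ Fin.suc))

ActsAsShift : Series → ℕ → Set
ActsAsShift f l = ∃₂ λ s t → shiftⁿ s (ppow onePlusX l · f) ≈ shiftⁿ t f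

module _ (f : Series) where

  private
    Y : ℕ → Series → Series
    Y l g = ppow onePlusX l · g

    Y-+ : ∀ a b g → Y (a + b) g ≗ Y a (Y b g)
    Y-+ = ·-ppow-+ onePlusX

    Y-shiftⁿ : ∀ a k g → Y a (shiftⁿ k g) ≗ shiftⁿ k (Y a g)
    Y-shiftⁿ a = ·-shiftⁿ (ppow onePlusX a)

    Y-resp-≈ : ∀ a {g h} → g ≈ h → Y a g ≈ Y a h
    Y-resp-≈ a = ·-resp-≈ (ppow onePlusX a)

    shiftⁿ-Y-shiftⁿ : ∀ s a u g → shiftⁿ s (Y a (shiftⁿ u g)) ≗ shiftⁿ u (shiftⁿ s (Y a g))
    shiftⁿ-Y-shiftⁿ s a u g n =
      trans (shiftⁿ-cong s (Y-shiftⁿ a u g) n) (shiftⁿ-comm s u (Y a g) n)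

  actsAsShift-0 : ActsAsShift f 0
  actsAsShift-0 = 0 , 0 , ≗⇒≈ (·-one f)

  actsAsShift-+ : ∀ {a b} → ActsAsShift f a → ActsAsShift f b → ActsAsShift f (a + b)
  actsAsShift-+ {a} {b} (s , t , Ya) (u , v , Yb) = s + u , v + t , (begin
    shiftⁿ (s + u) (Y (a + b) f)       ≈⟨ ≗⇒≈ (shiftⁿ-cong (s + u) (Y-+ a b f)) ⟩
    shiftⁿ (s + u) (Y a (Y b f))       ≈⟨ ≗⇒≈ (shiftⁿ-+ s u (Y a (Y b f))) ⟨
    shiftⁿ s (shiftⁿ u (Y a (Y b f)))  ≈⟨ ≗⇒≈ (shiftⁿ-cong s (Y-shiftⁿ a u (Y b f))) ⟨
    shiftⁿ s (Y a (shiftⁿ u (Y b f)))  ≈⟨ shiftⁿ-resp-≈ s (Y-resp-≈ a Yb) ⟩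
    shiftⁿ s (Y a (shiftⁿ v f))        ≈⟨ ≗⇒≈ (shiftⁿ-Y-shiftⁿ s a v f) ⟩
    shiftⁿ v (shiftⁿ s (Y a f))        ≈⟨ shiftⁿ-resp-≈ v Ya ⟩
    shiftⁿ v (shiftⁿ t f)              ≈⟨ ≗⇒≈ (shiftⁿ-+ v t f) ⟩
    shiftⁿ (v + t) f                   ∎)
    where open ≈-Reasoning

  actsAsShift-∸ : ∀ {a b} → ActsAsShift f a → ActsAsShift f (b + a) → ActsAsShift f b
  actsAsShift-∸ {a} {b} (s , t , Ya) (u , v , Yba) = u + t , s + v , (begin
    shiftⁿ (u + t) (Y b f)             ≈⟨ ≗⇒≈ (shiftⁿ-+ u t (Y b f)) ⟨
    shiftⁿ u (shiftⁿ t (Y b f))        ≈⟨ ≗⇒≈ (shiftⁿ-cong u (Y-shiftⁿ b t f)) ⟨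
    shiftⁿ u (Y b (shiftⁿ t f))        ≈⟨ shiftⁿ-resp-≈ u (Y-resp-≈ b (≈-sym Ya)) ⟩
    shiftⁿ u (Y b (shiftⁿ s (Y a f)))  ≈⟨ ≗⇒≈ (shiftⁿ-Y-shiftⁿ u b s (Y a f)) ⟩
    shiftⁿ s (shiftⁿ u (Y b (Y a f)))  ≈⟨ ≗⇒≈ (shiftⁿ-cong s (shiftⁿ-cong u (Y-+ b a f))) ⟨
    shiftⁿ s (shiftⁿ u (Y (b + a) f))  ≈⟨ shiftⁿ-resp-≈ s Yba ⟩
    shiftⁿ s (shiftⁿ v f)              ≈⟨ ≗⇒≈ (shiftⁿ-+ s v f) ⟩
    shiftⁿ (s + v) f                   ∎)
    where open ≈-Reasoning

  actsAsShift-gcdFin : ∀ m (l : Fin m → ℕ) → (∀ j → ActsAsShift f (l j)) →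
                       ActsAsShift f (gcdFin m l)
  actsAsShift-gcdFin = gcdFin-closed (ActsAsShift f) actsAsShift-0
    (λ {a} {b} → actsAsShift-+ {a} {b}) (λ {a} {b} → actsAsShift-∸ {a} {b})

  actsAsShift-denA : ∀ P l r → IsQuot f P (denA l r) → ActsAsShift f l
  actsAsShift-denA P l r f≡P/D =
    0 , r , ⊕≈0ₛ⇒≈ (≈-trans (≗⇒≈ (λ n → sym (·-denA l r f n))) (IsQuot⇒≈0ₛ f P (denA l r) f≡P/D))

  actsAsShift-denB : ∀ P l r → IsQuot f P (denB l r) → ActsAsShift f l
  actsAsShift-denB P l r f≡P/D =
    r , 0 , ⊕≈0ₛ⇒≈ (≈-trans (≗⇒≈ (λ n → sym (·-denB l r f n))) (IsQuot⇒≈0ₛ f P (denB l r) f≡P/D))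

  actsAsShift-quot : ∀ P l r → IsQuot f P (denA l r) ⊎ IsQuot f P (denB l r) → ActsAsShift f l
  actsAsShift-quot P l r (inj₁ f≡P/D) = actsAsShift-denA P l r f≡P/D
  actsAsShift-quot P l r (inj₂ f≡P/D) = actsAsShift-denB P l r f≡P/D

  eventually-periodic-quot : ∀ P l r → 1 ≤ r →
    IsQuot f P (denA l r) ⊎ IsQuot f P (denB l r) → EventuallyPeriodic f
  eventually-periodic-quot P l r r≥1 (inj₁ f≡P/D) =
    eventually-periodic (denA l r) (coeff₀-denA l r≥1) (IsQuot⇒≈0ₛ f P (denA l r) f≡P/D)
  eventually-periodic-quot P l r r≥1 (inj₂ f≡P/D) =
    eventually-periodic (denB l r) (coeff₀-denB l r≥1) (IsQuot⇒≈0ₛ f P (denB l r) f≡P/D)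

  period-beyond : EventuallyPeriodic f → ∀ s → ∃ λ K → s < K × shiftⁿ K f ≈ f
  period-beyond (N , N≥1 , per) zero    = N , N≥1 , per
  period-beyond (N , N≥1 , per) (suc s) with period-beyond (N , N≥1 , per) s
  ... | K , s<K , perK = N + K , +-mono-≤ N≥1 s<K ,
    ≈-trans (≗⇒≈ (λ n → sym (shiftⁿ-+ N K f n))) (≈-trans (shiftⁿ-resp-≈ N perK) per)

  -- The period lets us cancel the factor X^s.
  quot-denA : EventuallyPeriodic f → ∀ l → ActsAsShift f l →
              ∃₂ λ Q r → 1 ≤ r × IsQuot f Q (denA l r)
  quot-denA periodic l (s , t , Yl) with period-beyond periodic s
  ... | K , s<K , perK =
    let Q , f≡Q/D = ≈0ₛ⇒IsQuot f (denA l r) (≈-trans (≗⇒≈ (·-denA l r f)) (≈⇒⊕≈0ₛ Yl≈shift))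
    in  Q , r , ≤-trans (m<n⇒0<n∸m s<K) (m≤m+n _ t) , f≡Q/D
    where
    open ≈-Reasoning
    r = K ∸ s + t
    Yl≈shift : Y l f ≈ shiftⁿ r f
    Yl≈shift = begin
      Y l f                              ≈⟨ Y-resp-≈ l perK ⟨
      Y l (shiftⁿ K f)                   ≈⟨ ≗⇒≈ (Y-shiftⁿ l K f) ⟩
      shiftⁿ K (Y l f)                   ≈⟨ ≗⇒≈ (λ n → cong (λ k → shiftⁿ k (Y l f) n)
                                                          (sym (m∸n+n≡m (<⇒≤ s<K)))) ⟩
      shiftⁿ (K ∸ s + s) (Y l f)         ≈⟨ ≗⇒≈ (shiftⁿ-+ (K ∸ s) s (Y l f)) ⟨
      shiftⁿ (K ∸ s) (shiftⁿ s (Y l f))  ≈⟨ shiftⁿ-resp-≈ (K ∸ s) Yl ⟩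
      shiftⁿ (K ∸ s) (shiftⁿ t f)        ≈⟨ ≗⇒≈ (shiftⁿ-+ (K ∸ s) t f) ⟩
      shiftⁿ r f                         ∎

theorem4 : (f : Series) (m : ℕ) → 1 ≤ m →
    (P : Fin m → Poly) (r l : Fin m → ℕ) →
    (∀ j → 1 ≤ r j) → (∀ j → 1 ≤ l j) →
    (∀ j → IsQuot f (P j) (denA (l j) (r j)) ⊎ IsQuot f (P j) (denB (l j) (r j))) →
    Σ Poly (λ Q → Σ ℕ (λ s → 1 ≤ s ×
      (IsQuot f Q (denA (gcdFin m l) s) ⊎ IsQuot f Q (denB (gcdFin m l) s))))
theorem4 f (suc m) _ P r l r≥1 _ f≡P/D =
  let Q , s , s≥1 , f≡Q/D = quot-denA f periodic (gcdFin (suc m) l) acts-gcd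
  in  Q , s , s≥1 , inj₁ f≡Q/D
  where
  periodic : EventuallyPeriodic f
  periodic = eventually-periodic-quot f (P 0F) (l 0F) (r 0F) (r≥1 0F) (f≡P/D 0F)

  acts-gcd : ActsAsShift f (gcdFin (suc m) l)
  acts-gcd = actsAsShift-gcdFin f (suc m) l (λ j → actsAsShift-quot f (P j) (l j) (r j) (f≡P/D j))
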